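{- Let $\mathcal H\subseteq 2^V$ be a $c$-intersecting hypergraph, $\mathcal L:V\to 2^{[k]}$ a mapping, $\chi:V\to[0:k]$ a proper partial $\mathcal L$-coloring of $\mathcal H$, and $S\subseteq V_0$ a set of vertices such that no edge of $\mathcal H$ is contained in $V\setminus S$ (equivalently, every edge of $\mathcal H$ meets $S$). Fix an arbitrary assignment $\chi_p:V_0\setminus S\to[k]$ with $\chi_p(v)\in\mathcal L(v)$ for all $v$, and let $\widehat\chi=\chi\cup\chi_p$. Then $\chi$ is extendable to a proper $\mathcal L$-coloring of $\mathcal H$ if and only if either (i) $\chi$ is extendable to a proper $\mathcal L$-coloring $\chi'$ of $\mathcal H$ whose restriction to $V_0\setminus S$ equals $\chi_p$, or (ii) there exists $H\in\mathcal H\setminus(\mathcal H_0)_S$ with $|\widehat\chi(H\setminus S)|=1$ such that $\chi$ is extendable to a proper $\mathcal L$-coloring $\chi'$ of $\mathcal H$ assigning to every vertex of $H\cap S$ the unique color in $\widehat\chi(H\setminus S)$.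
   Context: $\mathcal H\subseteq 2^V$ is $c$-intersecting if every edge is disjoint from at most $c$ edges of $\mathcal H$. $[k]=\{1,\dots,k\}$, $[0:k]=\{0,\dots,k\}$. A partial $\mathcal L$-coloring is $\chi:V\to[0:k]$ with $\chi(v)\in\mathcal L(v)\cup\{0\}$ ($0$ = uncolored); it is proper if no fully colored edge is monochromatic. $V_0=\{v:\chi(v)=0\}$; $\mathcal H_0=\{H\in\mathcal H:\chi(H)=\{0\}\}$, where $\chi(H)=\{\chi(v):v\in H\}$. For a hypergraph $\mathcal G$ and set $S$, $\mathcal G_S=\{G\in\mathcal G:G\subseteq S\}$. For $\chi_p$ defined on a subset $A\subseteq V_0$, $\chi\cup\chi_p$ equals $\chi_p$ on $A$ and $\chi$ elsewhere. An extension of $\chi$ to an $\mathcal L$-coloring is $\chi':V\to[k]$ with $\chi'(v)\in\mathcal L(v)$ and $\chi'=\chi$ on $V\setminus V_0$; it is proper if $|\chi'(H)|\ge2$ for every $H\in\mathcal H$. -}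

module Defs where

import Data.Nat as ℕ
open import Data.Nat using (ℕ; _≤_)
open import Data.Fin using (Fin; zero; suc)
open import Data.Fin.Subset using (Subset; _∈_; _∉_; _⊆_; _∩_; Empty; ∣_∣)
open import Data.Fin.Subset.Properties using (_∈?_)
open import Data.Product using (Σ; ∃; _×_)
open import Data.Sum using (_⊎_)
open import Relation.Binary.PropositionalEquality using (_≡_; _≢_)
open import Relation.Nullary using (¬_; yes; no)
open import Function.Definitions using (Injective)

-- The colour set [k] is represented by Fin k
-- (index i stands for colour i+1); [0:k] is represented by Fin (1+k),
-- where `zero` means "uncoloured" (colour 0) and `suc i` is colour i+1.

-- A hypergraph ℋ ⊆ 2^V with m edges: an injective family of vertex
-- subsets (injectivity: it is a *set* of edges).
record Hypergraph (n : ℕ) : Set where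
  field
    m        : ℕ
    edge     : Fin m → Subset n
    edge-inj : Injective _≡_ _≡_ edge
open Hypergraph public

Disjoint : ∀ {n} → Subset n → Subset n → Set
Disjoint A B = Empty (A ∩ B)

CIntersecting : ∀ {n} → ℕ → Hypergraph n → Set
CIntersecting c ℋ =
  ∀ (i : Fin (m ℋ)) (D : Subset (m ℋ)) →
    (∀ j → j ∈ D → Disjoint (edge ℋ i) (edge ℋ j)) → ∣ D ∣ ≤ c

Monochromatic : ∀ {n} {A : Set} → (Fin n → A) → Subset n → Set
Monochromatic f H = ∃ λ a → (∃ λ v → v ∈ H) × (∀ v → v ∈ H → f v ≡ a)

Polychromatic : ∀ {n} {A : Set} → (Fin n → A) → Subset n → Set
Polychromatic f H = ∃ λ u → ∃ λ v → u ∈ H × v ∈ H × f u ≢ f v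

IsPartialLColoring : ∀ {n k} → (Fin n → Subset k) → (Fin n → Fin (ℕ.suc k)) → Set
IsPartialLColoring {n} {k} L χ =
  ∀ v → χ v ≡ zero ⊎ (∃ λ (i : Fin k) → χ v ≡ suc i × i ∈ L v)

IsProperPartial : ∀ {n k} → Hypergraph n → (Fin n → Fin (ℕ.suc k)) → Set
IsProperPartial ℋ χ =
  ∀ (i : Fin (m ℋ)) → (∀ v → v ∈ edge ℋ i → χ v ≢ zero) →
    ¬ Monochromatic χ (edge ℋ i)

InV₀ : ∀ {n k} → (Fin n → Fin (ℕ.suc k)) → Fin n → Set
InV₀ χ v = χ v ≡ zero

InH₀ : ∀ {n k} → (Fin n → Fin (ℕ.suc k)) → Subset n → Set
InH₀ χ H = (∃ λ v → v ∈ H) × (∀ v → v ∈ H → χ v ≡ zero)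

IsProperExtension : ∀ {n k} → Hypergraph n → (Fin n → Subset k) →
  (Fin n → Fin (ℕ.suc k)) → (Fin n → Fin k) → Set
IsProperExtension ℋ L χ χ' =
  (∀ v → χ' v ∈ L v) ×
  (∀ v → ¬ InV₀ χ v → χ v ≡ suc (χ' v)) ×
  (∀ (i : Fin (m ℋ)) → Polychromatic χ' (edge ℋ i))

chiHat : ∀ {n k} → (Fin n → Fin (ℕ.suc k)) → Subset n → (Fin n → Fin k) →
  Fin n → Fin (ℕ.suc k)
chiHat χ S χp v with χ v
... | suc c = suc c
... | zero with v ∈? S
...   | yes _ = zero
...   | no  _ = suc (χp v)

module Submission where

-- Only "⇒" has content ("⇐" forgets the extra information).
-- Given a proper extension χ' of χ, overwrite it by χp on the free vertices
-- outside S, obtaining the patched colouring χ₂ (= χ' on S and on the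
-- vertices coloured by χ, = χp on V₀ ∖ S).  χ₂ is again an L-colouring
-- extending χ.  Choose in every edge H a vertex w_H ∈ H ∩ S.  Either
--   * every edge is polychromatic under χ₂: then χ₂ witnesses (i); or
--   * some edge H is constant under χ₂, with colour a = χ₂(w_H).  Then
--     χ̂ = 1 + χ₂ outside S, so χ̂(H ∖ S) = {1 + a}; and χ' = χ₂ on H ∩ S, so
--     χ' itself witnesses (ii).  H ∖ S is non-empty, for otherwise χ' = χ₂
--     would be constant on H; in particular H ∉ (ℋ₀)_S.

open import Defs
open import Data.Nat using (ℕ) renaming (suc to sucℕ)
open import Data.Fin using (Fin; zero; suc)
open import Data.Fin.Subset using (Subset; _∈_; _∉_; _⊆_)
open import Data.Product using (∃; _×_)
open import Data.Sum using (_⊎_)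
open import Relation.Binary.PropositionalEquality using (_≡_)
open import Relation.Nullary using (¬_)
open import Function.Bundles using (_⇔_)

open import Data.Fin.Subset.Properties using (_∈?_)
open import Data.Fin.Properties using (all?; any?; ¬∀⟶∃¬) renaming (_≟_ to _≟ᶠ_)
open import Data.Product using (_,_; proj₁; proj₂)
open import Data.Sum using (inj₁; inj₂; [_,_])
open import Data.Empty using (⊥-elim)
open import Relation.Nullary using (Dec; yes; no; ¬?; _×-dec_; _→-dec_)
open import Relation.Binary.Definitions using (DecidableEquality)
open import Relation.Binary.PropositionalEquality using (refl; sym; trans; cong; module ≡-Reasoning)
open import Function.Bundles using (mk⇔)
open import Function.Base using (_∘_)

Constant : ∀ {n} {A : Set} → (Fin n → A) → Subset n → Fin n → Set
Constant f H w = ∀ v → v ∈ H → f v ≡ f w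

module _ {n : ℕ} {A : Set} (_≟_ : DecidableEquality A) where

  constant? : (f : Fin n → A) (H : Subset n) (w : Fin n) → Dec (Constant f H w)
  constant? f H w = all? (λ v → (v ∈? H) →-dec (f v ≟ f w))

  nonconstant⇒polychromatic : (f : Fin n → A) {H : Subset n} {w : Fin n} →
    w ∈ H → ¬ Constant f H w → Polychromatic f H
  nonconstant⇒polychromatic f {H} {w} w∈H ¬const
    with ¬∀⟶∃¬ n (λ v → v ∈ H → f v ≡ f w)
                 (λ v → (v ∈? H) →-dec (f v ≟ f w)) ¬const
  ... | v , ¬eq with v ∈? H
  ...   | yes v∈H = w , v , w∈H , v∈H , λ fw≡fv → ¬eq (λ _ → sym fw≡fv)
  ...   | no  v∉H = ⊥-elim (¬eq (λ v∈H → ⊥-elim (v∉H v∈H)))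

  polychromatic-or-constant-edge : (ℋ : Hypergraph n) (f : Fin n → A)
    (w : Fin (m ℋ) → Fin n) → (∀ i → w i ∈ edge ℋ i) →
    (∀ i → Polychromatic f (edge ℋ i)) ⊎ (∃ λ i → Constant f (edge ℋ i) (w i))
  polychromatic-or-constant-edge ℋ f w w∈edge
    with any? (λ i → constant? f (edge ℋ i) (w i))
  ... | yes constant-edge = inj₂ constant-edge
  ... | no  ¬constant-edge = inj₁ λ i →
        nonconstant⇒polychromatic f (w∈edge i) (λ const → ¬constant-edge (i , const))

constant⇒¬polychromatic : ∀ {n} {A : Set} (f : Fin n → A) {H : Subset n} {w : Fin n} →
  Constant f H w → ¬ Polychromatic f H
constant⇒¬polychromatic f const (u , v , u∈H , v∈H , fu≢fv) =
  fu≢fv (trans (const u u∈H) (sym (const v v∈H)))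

module Patch {n k : ℕ} (χ : Fin n → Fin (sucℕ k)) (S : Subset n)
             (χp χ' : Fin n → Fin k) where

  Free : Fin n → Set
  Free v = InV₀ χ v × v ∉ S

  free? : ∀ v → Dec (Free v)
  free? v = (χ v ≟ᶠ zero) ×-dec ¬? (v ∈? S)

  patch : Fin n → Fin k
  patch v with free? v
  ... | yes _ = χp v
  ... | no  _ = χ' v

  patch-free : ∀ {v} → Free v → patch v ≡ χp v
  patch-free {v} free with free? v
  ... | yes _    = refl
  ... | no ¬free = ⊥-elim (¬free free)

  patch-fixed : ∀ {v} → ¬ Free v → patch v ≡ χ' v
  patch-fixed {v} ¬free with free? v
  ... | yes free = ⊥-elim (¬free free)
  ... | no  _    = refl

  patch-on-S : ∀ {v} → v ∈ S → patch v ≡ χ' v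
  patch-on-S v∈S = patch-fixed (λ (_ , v∉S) → v∉S v∈S)

  patch-coloured : ∀ {v} → ¬ InV₀ χ v → patch v ≡ χ' v
  patch-coloured coloured = patch-fixed (λ (uncoloured , _) → coloured uncoloured)

  chiHat-coloured : ∀ {v} → ¬ InV₀ χ v → chiHat χ S χp v ≡ χ v
  chiHat-coloured {v} coloured with χ v
  ... | suc _ = refl
  ... | zero  = ⊥-elim (coloured refl)

  chiHat-free : ∀ {v} → Free v → chiHat χ S χp v ≡ suc (χp v)
  chiHat-free {v} (uncoloured , v∉S) with χ v
  ... | suc _ with () ← uncoloured
  ... | zero with v ∈? S
  ...   | yes v∈S = ⊥-elim (v∉S v∈S)
  ...   | no  _   = refl

  -- Outside S the colouring χ̂ = χ ∪ χp is the patched colouring, shifted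
  -- into [0:k]; this identifies the colour of χ̂ on H ∖ S in case (ii).
  chiHat-patch : (∀ v → ¬ InV₀ χ v → χ v ≡ suc (χ' v)) →
    ∀ {v} → v ∉ S → chiHat χ S χp v ≡ suc (patch v)
  chiHat-patch agrees {v} v∉S with free? v
  ... | yes free = chiHat-free free
  ... | no ¬free = trans (chiHat-coloured coloured) (agrees v coloured)
    where
    coloured : ¬ InV₀ χ v
    coloured uncoloured = ¬free (uncoloured , v∉S)

  patch-extension : ∀ {ℋ : Hypergraph n} {L : Fin n → Subset k} →
    (∀ v → Free v → χp v ∈ L v) →
    IsProperExtension ℋ L χ χ' →
    (∀ i → Polychromatic patch (edge ℋ i)) →
    IsProperExtension ℋ L χ patch
  patch-extension {L = L} χp∈L (χ'∈L , agrees , _) poly = patch∈L , patch-agrees , poly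
    where
    patch∈L : ∀ v → patch v ∈ L v
    patch∈L v with free? v
    ... | yes free = χp∈L v free
    ... | no  _    = χ'∈L v

    patch-agrees : ∀ v → ¬ InV₀ χ v → χ v ≡ suc (patch v)
    patch-agrees v coloured =
      trans (agrees v coloured) (cong suc (sym (patch-coloured coloured)))

  -- An edge on which the patched colouring is constant, while χ' is
  -- polychromatic, must leave S (the two colourings agree on S).
  constant-edge-leaves-S : ∀ {H : Subset n} {w : Fin n} →
    Polychromatic χ' H → Constant patch H w → w ∈ S →
    ∃ λ v → v ∈ H × v ∉ S
  constant-edge-leaves-S {H} {w} poly const w∈S
    with any? (λ v → (v ∈? H) ×-dec ¬? (v ∈? S))
  ... | yes outside = outside
  ... | no ¬outside = ⊥-elim (constant⇒¬polychromatic χ' χ'-constant poly)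
    where
    H⊆S : ∀ {v} → v ∈ H → v ∈ S
    H⊆S {v} v∈H with v ∈? S
    ... | yes v∈S = v∈S
    ... | no  v∉S = ⊥-elim (¬outside (v , v∈H , v∉S))

    χ'-constant : Constant χ' H w
    χ'-constant v v∈H = begin
      χ' v     ≡⟨ sym (patch-on-S (H⊆S v∈H)) ⟩
      patch v  ≡⟨ const v v∈H ⟩
      patch w  ≡⟨ patch-on-S w∈S ⟩
      χ' w     ∎
      where open ≡-Reasoning

ExtendsThrough : ∀ {n k} → Hypergraph n → (Fin n → Subset k) →
  (Fin n → Fin (sucℕ k)) → Subset n → (Fin n → Fin k) → Set
ExtendsThrough ℋ L χ S χp =
  ∃ λ χ' → IsProperExtension ℋ L χ χ' × (∀ v → InV₀ χ v → v ∉ S → χ' v ≡ χp v)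

ForcedOnEdge : ∀ {n k} → Hypergraph n → (Fin n → Subset k) →
  (Fin n → Fin (sucℕ k)) → Subset n → (Fin n → Fin k) → Set
ForcedOnEdge {k = k} ℋ L χ S χp =
  ∃ λ (i : Fin (m ℋ)) →
    ¬ (edge ℋ i ⊆ S × InH₀ χ (edge ℋ i)) ×
    ∃ λ (a : Fin (sucℕ k)) →
      (∃ λ v → v ∈ edge ℋ i × v ∉ S) ×
      (∀ v → v ∈ edge ℋ i → v ∉ S → chiHat χ S χp v ≡ a) ×
      (∃ λ χ' → IsProperExtension ℋ L χ χ' ×
        (∀ v → v ∈ edge ℋ i → v ∈ S → suc (χ' v) ≡ a))

extension⇒alternatives : ∀ {n k} (ℋ : Hypergraph n) (L : Fin n → Subset k)
  (χ : Fin n → Fin (sucℕ k)) (S : Subset n) (χp : Fin n → Fin k) →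
  (∀ (i : Fin (m ℋ)) → ∃ λ v → v ∈ edge ℋ i × v ∈ S) →
  (∀ v → InV₀ χ v → v ∉ S → χp v ∈ L v) →
  ∃ (IsProperExtension ℋ L χ) →
  ExtendsThrough ℋ L χ S χp ⊎ ForcedOnEdge ℋ L χ S χp
extension⇒alternatives {n} ℋ L χ S χp edge-meets-S χp∈L (χ' , ext@(_ , agrees , χ'-proper)) =
  [ inj₁ ∘ patch-extends , inj₂ ∘ edge-forced ]
    (polychromatic-or-constant-edge _≟ᶠ_ ℋ patch w w∈edge)
  where
  open Patch χ S χp χ'

  w : Fin (m ℋ) → Fin n
  w i = proj₁ (edge-meets-S i)

  w∈edge : ∀ i → w i ∈ edge ℋ i
  w∈edge i = proj₁ (proj₂ (edge-meets-S i))

  w∈S : ∀ i → w i ∈ S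
  w∈S i = proj₂ (proj₂ (edge-meets-S i))

  patch-extends : (∀ i → Polychromatic patch (edge ℋ i)) → ExtendsThrough ℋ L χ S χp
  patch-extends proper =
    patch , patch-extension {ℋ = ℋ} (λ v (z , v∉S) → χp∈L v z v∉S) ext proper
          , λ v z v∉S → patch-free (z , v∉S)

  edge-forced : (∃ λ i → Constant patch (edge ℋ i) (w i)) → ForcedOnEdge ℋ L χ S χp
  edge-forced (i , const) =
    i , not-in-S , suc (patch (w i)) , outside
      , (λ v v∈H v∉S → trans (chiHat-patch agrees v∉S) (cong suc (const v v∈H)))
      , χ' , ext
      , λ v v∈H v∈S → cong suc (trans (sym (patch-on-S v∈S)) (const v v∈H))
    where
    outside : ∃ λ v → v ∈ edge ℋ i × v ∉ S
    outside = constant-edge-leaves-S (χ'-proper i) const (w∈S i)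

    not-in-S : ¬ (edge ℋ i ⊆ S × InH₀ χ (edge ℋ i))
    not-in-S (H⊆S , _) = proj₂ (proj₂ outside) (H⊆S (proj₁ (proj₂ outside)))

alternatives⇒extension : ∀ {n k} (ℋ : Hypergraph n) (L : Fin n → Subset k)
  (χ : Fin n → Fin (sucℕ k)) (S : Subset n) (χp : Fin n → Fin k) →
  ExtendsThrough ℋ L χ S χp ⊎ ForcedOnEdge ℋ L χ S χp → ∃ (IsProperExtension ℋ L χ)
alternatives⇒extension _ _ _ _ _ (inj₁ (χ' , ext , _))                   = χ' , ext
alternatives⇒extension _ _ _ _ _ (inj₂ (_ , _ , _ , _ , _ , χ' , ext , _)) = χ' , ext

lemma4 : ∀ {n k : ℕ} (c : ℕ) (ℋ : Hypergraph n) (L : Fin n → Subset k)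
           (χ : Fin n → Fin (sucℕ k)) (S : Subset n) (χp : Fin n → Fin k) →
         CIntersecting c ℋ →
         IsPartialLColoring L χ →
         IsProperPartial ℋ χ →
         (∀ v → v ∈ S → InV₀ χ v) →
         (∀ (i : Fin (m ℋ)) → ∃ λ v → v ∈ edge ℋ i × v ∈ S) →
         (∀ v → InV₀ χ v → v ∉ S → χp v ∈ L v) →
         (∃ λ χ' → IsProperExtension ℋ L χ χ')
         ⇔
         ((∃ λ χ' → IsProperExtension ℋ L χ χ' ×
                    (∀ v → InV₀ χ v → v ∉ S → χ' v ≡ χp v))
          ⊎
          (∃ λ (i : Fin (m ℋ)) →
             ¬ (edge ℋ i ⊆ S × InH₀ χ (edge ℋ i)) ×
             -- |χ̂(H ∖ S)| = 1 with unique colour a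
             ∃ λ (a : Fin (sucℕ k)) →
               (∃ λ v → v ∈ edge ℋ i × v ∉ S) ×
               (∀ v → v ∈ edge ℋ i → v ∉ S → chiHat χ S χp v ≡ a) ×
               (∃ λ χ' → IsProperExtension ℋ L χ χ' ×
                  (∀ v → v ∈ edge ℋ i → v ∈ S → suc (χ' v) ≡ a))))
lemma4 c ℋ L χ S χp _ _ _ _ edge-meets-S χp∈L =
  mk⇔ (extension⇒alternatives ℋ L χ S χp edge-meets-S χp∈L)
      (alternatives⇒extension ℋ L χ S χp)
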